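{- No flower is a Burling graph.
   Context: Rooted trees: for a rooted tree $(T,r)$ and $v\neq r$, $p(v)$ is the parent of $v$. A branch is a path $v_1v_2\dots v_k$ of $T$ with $v_i$ the parent of $v_{i+1}$ for all $i$ (it starts at $v_1$); a branch may be empty. A Burling tree is a 4-tuple $(T,r,\ell,c)$ where $T$ is a rooted tree with root $r$; $\ell$ assigns to every non-leaf vertex $v$ one of its children $\ell(v)$, the last-born of $v$; and $c$ is a function on $V(T)$ such that if $v\neq r$ is not a last-born then $c(v)$ is the vertex set of a (possibly empty) branch of $T$ starting at $\ell(p(v))$, while $c(v)=\varnothing$ if $v$ is the root or a last-born. The oriented graph fully derived from the Burling tree has vertex set $V(T)$ and an arc $uv$ iff $v\in c(u)$. An oriented graph is derived from the Burling tree if it is an induced subgraph of the fully derived oriented graph. A (non-oriented) Burling graph is the underlying graph of an oriented graph derived from some Burling tree. A hole in a graph is an induced cycle of length at least $4$. A flower is a graph $G$ consisting of a hole $H$ such that every edge $e$ of $H$ is contained in a hole $H_e$ of $G$, where $V(H)\cap V(H_e)=e$ (the two ends of $e$), $V(H_e)\cap V(H_f)=e\cap f$ for all edges $e\neq f$ of $H$, and the vertices and edges of $G$ are exactly those of the holes $H_e$. -}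

module Defs where

open import Data.Nat using (ℕ; zero; suc; _≤_)
open import Data.Fin using (Fin; toℕ)
open import Data.Maybe using (Maybe; just; nothing)
open import Data.List using (List; []; _∷_)
open import Data.List.Membership.Propositional using (_∈_)
open import Data.Product using (Σ; _×_; ∃; _,_)
open import Data.Sum using (_⊎_)
open import Data.Empty using (⊥)
open import Relation.Nullary using (¬_)
open import Relation.Binary.PropositionalEquality using (_≡_; _≢_)
open import Function.Bundles using (_⇔_)
open import Function.Definitions using (Injective)

record Graph (m : ℕ) : Set₁ where
  field
    Adj     : Fin m → Fin m → Set
    sym     : ∀ {x y} → Adj x y → Adj y x
    irrefl  : ∀ {x} → ¬ Adj x x
open Graph public

Consec : (k : ℕ) → Fin k → Fin k → Set
Consec k i j = (suc (toℕ i) ≡ toℕ j) ⊎ ((suc (toℕ i) ≡ k) × (toℕ j ≡ 0))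

CycAdj : (k : ℕ) → Fin k → Fin k → Set
CycAdj k i j = Consec k i j ⊎ Consec k j i

-- A hole: an induced cycle of length at least 4, given by a cyclic
-- enumeration of its vertices.
record Hole {m : ℕ} (G : Graph m) : Set where
  field
    len    : ℕ
    len≥4  : 4 ≤ len
    vtx    : Fin len → Fin m
    inj    : Injective _≡_ _≡_ vtx
    adj⇔   : ∀ i j → Adj G (vtx i) (vtx j) ⇔ CycAdj len i j
open Hole public

_∈H_ : ∀ {m} {G : Graph m} → Fin m → Hole G → Set
x ∈H H = ∃ λ i → vtx H i ≡ x

-- the i-th edge of a hole H is {vtx i, vtx j} where j follows i;
-- InEdge H i x  means x is an end of that edge
InEdge : ∀ {m} {G : Graph m} → (H : Hole G) → Fin (len H) → Fin m → Set
InEdge H i x = (vtx H i ≡ x) ⊎ (∃ λ j → Consec (len H) i j × vtx H j ≡ x)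

record IsFlower {m : ℕ} (G : Graph m) : Set₁ where
  field
    H      : Hole G
    petal  : Fin (len H) → Hole G
    meetH  : ∀ i x → ((x ∈H H) × (x ∈H petal i)) ⇔ InEdge H i x
    meetP  : ∀ i j → i ≢ j → ∀ x →
               ((x ∈H petal i) × (x ∈H petal j)) ⇔ (InEdge H i x × InEdge H j x)
    coverV : ∀ x → ∃ λ i → x ∈H petal i
    coverE : ∀ x y → Adj G x y → ∃ λ i → (x ∈H petal i) × (y ∈H petal i)

data ReachRoot {n : ℕ} (par : Fin n → Maybe (Fin n)) (r : Fin n) : Fin n → Set where
  here  : ReachRoot par r r
  there : ∀ {v u} → par v ≡ just u → ReachRoot par r u → ReachRoot par r v

data Chain {n : ℕ} (par : Fin n → Maybe (Fin n)) : List (Fin n) → Set where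
  []   : Chain par []
  [_]  : ∀ v → Chain par (v ∷ [])
  step : ∀ {v w vs} → par w ≡ just v → Chain par (w ∷ vs) → Chain par (v ∷ w ∷ vs)

record BurlingTree (n : ℕ) : Set₁ where
  field
    root      : Fin n
    par       : Fin n → Maybe (Fin n)
    par-root  : par root ≡ nothing
    par-other : ∀ v → par v ≡ nothing → v ≡ root
    reach     : ∀ v → ReachRoot par root v
    -- last-born: ℓ u is a child of u whenever u is not a leaf
    -- (the value of ℓ at leaves is irrelevant)
    ℓ         : Fin n → Fin n
    ℓ-child   : ∀ u v → par v ≡ just u → par (ℓ u) ≡ just u
    c         : Fin n → Fin n → Set
    c-root    : ∀ x → ¬ c root x
    c-last    : ∀ v u → par v ≡ just u → ℓ u ≡ v → ∀ x → ¬ c v x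
    c-branch  : ∀ v u → par v ≡ just u → ℓ u ≢ v →
                  (∀ x → ¬ c v x)
                  ⊎ (Σ (List (Fin n)) λ vs → Chain par (ℓ u ∷ vs)
                       × (∀ x → c v x ⇔ x ∈ (ℓ u ∷ vs)))
open BurlingTree public

-- G is a Burling graph: G is isomorphic to the underlying graph of an
-- induced subgraph of the oriented graph fully derived from some Burling tree.
IsBurling : ∀ {m} → Graph m → Set₁
IsBurling {m} G =
  Σ ℕ λ n → Σ (BurlingTree n) λ T → Σ (Fin m → Fin n) λ f →
    Injective _≡_ _≡_ f ×
    (∀ x y → Adj G x y ⇔ (c T (f x) (f y) ⊎ c T (f y) (f x)))

-- Fix a Burling representation and call x above y when f x is a proper ancestor of f y in the tree.
-- The ends of an arc are incomparable, the out-neighbours of a vertex lie on one branch and so are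
-- comparable, and a vertex above one end of an edge is above the other end or adjacent to it.
-- Hence every hole has a peak, a vertex above all its non-neighbours on the hole: a source of the hole
-- exists at or next to a vertex of least depth, and the higher of its two out-neighbours is a peak.
-- Let u be a peak of the central hole H of a flower, with neighbours t₁, t₂ on H. The petal at an edge
-- t u has its peak outside H: u is excluded by comparing the out-neighbours of t on H and on the two
-- petals at t, and t because u and t would send arcs to each other. The peaks of the petals at t₁ u and
-- t₂ u then turn out to be each above the other.

module Submission where

open import Defs hiding (sym; root; par; par-root; par-other; reach; ℓ; ℓ-child; c; c-root; c-last; c-branch)
open import Data.Nat using (ℕ; zero; suc; pred; _≤_; _<_; _≟_; _<?_; z≤n; s≤s; z<s; NonZero; >-nonZero)
open import Data.Nat.Properties
  using (≤-refl; ≤-trans; <-trans; <-≤-trans; ≤-<-trans; <⇒≱; <-irrefl; ≮⇒≥; ≤-antisym; <-cmp; n<1+n;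
         m≤n⇒m<n∨m≡n; suc-injective; suc-pred; <⇒≤pred; ≤-reflexive; m≤n⇒m≤1+n; <-asym)
open import Data.Fin using (Fin; toℕ; fromℕ<)
open import Data.Fin.Properties using (toℕ-injective; toℕ<n; fromℕ<-toℕ; toℕ-fromℕ<) renaming (_≟_ to _≟ᶠ_)
open import Data.Maybe using (just; nothing)
open import Data.Maybe.Properties using (just-injective)
open import Data.List using (List; _∷_; allFin)
open import Data.List.Extrema.Nat using (argmin; f[argmin]≤f[xs])
open import Data.List.Membership.Propositional.Properties using (∈-allFin)
import Data.List.Relation.Unary.All as All
open import Data.List.Membership.Propositional using (_∈_)
open import Data.List.Relation.Unary.Any using (here; there)
open import Data.Product using (Σ; _×_; _,_; proj₁; proj₂)
open import Data.Sum using (_⊎_; inj₁; inj₂)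
import Data.Sum as Sum
open import Data.Empty using (⊥; ⊥-elim)
open import Relation.Nullary using (¬_; yes; no; Dec)
open import Relation.Nullary.Decidable using (_⊎-dec_; _×-dec_; map′)
open import Relation.Binary.Definitions using (tri<; tri≈; tri>)
open import Relation.Binary.PropositionalEquality using (_≡_; _≢_; refl; sym; trans; cong; subst; subst₂)
open import Function.Bundles using (_⇔_; Equivalence; mk⇔)
import Function.Properties.Equivalence as ⇔
open import Function.Base using (_∘_; id)
open import Function.Definitions using (Injective)

module _ (P : ℕ → Set) (lo hi : ℕ) (link : ∀ x → lo ≤ x → suc x < hi → P x ⇔ P (suc x)) where

  interval-⇔ : ∀ x → lo ≤ x → x < hi → P lo ⇔ P x
  interval-⇔ x lo≤x x<hi with m≤n⇒m<n∨m≡n lo≤x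
  ... | inj₂ refl = ⇔.refl
  interval-⇔ (suc x) _ x<hi | inj₁ (s≤s lo≤x) =
    ⇔.trans (interval-⇔ x lo≤x (<-trans (n<1+n x) x<hi)) (link x lo≤x x<hi)

module Cycle (k : ℕ) (4≤k : 4 ≤ k) where

  private
    0<k : 0 < k
    0<k = <-≤-trans z<s 4≤k

    instance
      k-nonZero : NonZero k
      k-nonZero = >-nonZero 0<k

  Step : ℕ → ℕ → Set
  Step a b = suc a ≡ b ⊎ (suc a ≡ k × b ≡ 0)

  private
    k≮ : ∀ {x} → x ≡ k → x < 4 → ⊥
    k≮ refl x<4 = <⇒≱ x<4 4≤k

  Step-irrefl : ∀ {a} → ¬ Step a a
  Step-irrefl (inj₁ ())
  Step-irrefl (inj₂ (e , refl)) = k≮ e (s≤s (s≤s z≤n))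

  no-2-cycle : ∀ {a b} → Step a b → Step b a → ⊥
  no-2-cycle (inj₁ refl) (inj₁ ())
  no-2-cycle (inj₁ refl) (inj₂ (e , refl)) = k≮ e (s≤s (s≤s (s≤s z≤n)))
  no-2-cycle (inj₂ (e , refl)) (inj₁ refl) = k≮ e (s≤s (s≤s (s≤s z≤n)))
  no-2-cycle (inj₂ (_ , refl)) (inj₂ (e , refl)) = k≮ e (s≤s (s≤s z≤n))

  no-3-cycle : ∀ {a b c} → Step a b → Step b c → Step c a → ⊥
  no-3-cycle (inj₁ refl) (inj₁ refl) (inj₁ ())
  no-3-cycle (inj₁ refl) (inj₁ refl) (inj₂ (e , refl)) = k≮ e (s≤s (s≤s (s≤s (s≤s z≤n))))
  no-3-cycle (inj₁ refl) (inj₂ (e , refl)) (inj₁ refl) = k≮ e (s≤s (s≤s (s≤s (s≤s z≤n))))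
  no-3-cycle (inj₁ refl) (inj₂ (_ , refl)) (inj₂ (e , refl)) = k≮ e (s≤s (s≤s z≤n))
  no-3-cycle (inj₂ (e , refl)) (inj₁ refl) (inj₁ refl) = k≮ e (s≤s (s≤s (s≤s (s≤s z≤n))))
  no-3-cycle (inj₂ (_ , refl)) (inj₁ refl) (inj₂ (e , refl)) = k≮ e (s≤s (s≤s (s≤s z≤n)))
  no-3-cycle (inj₂ (_ , refl)) (inj₂ (e , refl)) (inj₁ refl) = k≮ e (s≤s (s≤s z≤n))
  no-3-cycle (inj₂ (_ , refl)) (inj₂ (e , refl)) (inj₂ (_ , refl)) = k≮ e (s≤s (s≤s z≤n))

  Step-functional : ∀ {a b c} → b < k → c < k → Step a b → Step a c → b ≡ c
  Step-functional _   _   (inj₁ refl)       (inj₁ refl)       = refl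
  Step-functional b<k _   (inj₁ refl)       (inj₂ (e , refl)) = ⊥-elim (<-irrefl e b<k)
  Step-functional _   c<k (inj₂ (e , refl)) (inj₁ refl)       = ⊥-elim (<-irrefl e c<k)
  Step-functional _   _   (inj₂ (_ , refl)) (inj₂ (_ , refl)) = refl

  Step-injective : ∀ {a b c} → Step a c → Step b c → a ≡ b
  Step-injective (inj₁ refl)       (inj₁ e)           = suc-injective (sym e)
  Step-injective (inj₂ (e , refl)) (inj₂ (e′ , refl)) = suc-injective (trans e (sym e′))

  Linked : ℕ → ℕ → Set
  Linked a b = Step a b ⊎ Step b a

  private
    two-out : ∀ {a b c} → b < k → c < k → Step a b → Step a c → ¬ Linked b c
    two-out b<k c<k ab ac with Step-functional b<k c<k ab ac
    ... | refl = Sum.[ Step-irrefl , Step-irrefl ]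

    two-in : ∀ {a b c} → Step a c → Step b c → ¬ Linked a b
    two-in ac bc with Step-injective ac bc
    ... | refl = Sum.[ Step-irrefl , Step-irrefl ]

  triangle-free : ∀ (i j l : Fin k) → CycAdj k i j → CycAdj k j l → CycAdj k i l → ⊥
  triangle-free i j l (inj₁ ij) (inj₁ jl) (inj₁ il) = two-out (toℕ<n j) (toℕ<n l) ij il (inj₁ jl)
  triangle-free i j l (inj₁ ij) (inj₁ jl) (inj₂ li) = no-3-cycle ij jl li
  triangle-free i j l (inj₁ ij) (inj₂ lj) il        = two-in ij lj il
  triangle-free i j l (inj₂ ji) (inj₁ jl) il        = two-out (toℕ<n i) (toℕ<n l) ji jl il
  triangle-free i j l (inj₂ ji) (inj₂ lj) (inj₁ il) = no-3-cycle il lj ji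
  triangle-free i j l (inj₂ ji) (inj₂ lj) (inj₂ li) = two-in ji li (inj₂ lj)

  CycAdj? : ∀ i j → Dec (CycAdj k i j)
  CycAdj? i j = Consec? i j ⊎-dec Consec? j i
    where
    Consec? : ∀ i j → Dec (Consec k i j)
    Consec? i j = (suc (toℕ i) ≟ toℕ j) ⊎-dec ((suc (toℕ i) ≟ k) ×-dec (toℕ j ≟ 0))

  private
    pred-k<k : pred k < k
    pred-k<k = ≤-reflexive (suc-pred k)

    prevℕ : ℕ → ℕ
    prevℕ zero    = pred k
    prevℕ (suc x) = x

    prevℕ<k : ∀ x → x < k → prevℕ x < k
    prevℕ<k zero    _   = pred-k<k
    prevℕ<k (suc x) x<k = <-trans (n<1+n x) x<k

    Step-prevℕ : ∀ x → Step (prevℕ x) x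
    Step-prevℕ zero    = inj₂ (suc-pred k , refl)
    Step-prevℕ (suc x) = inj₁ refl

  next : Fin k → Fin k
  next i with suc (toℕ i) <? k
  ... | yes i+1<k = fromℕ< i+1<k
  ... | no  _     = fromℕ< 0<k

  prev : Fin k → Fin k
  prev i = fromℕ< (prevℕ<k (toℕ i) (toℕ<n i))

  Step-next : ∀ i → Step (toℕ i) (toℕ (next i))
  Step-next i with suc (toℕ i) <? k
  ... | yes i+1<k = inj₁ (sym (toℕ-fromℕ< i+1<k))
  ... | no  i+1≮k = inj₂ (≤-antisym (toℕ<n i) (≮⇒≥ i+1≮k) , toℕ-fromℕ< 0<k)

  Step-prev : ∀ i → Step (toℕ (prev i)) (toℕ i)
  Step-prev i = subst (λ a → Step a (toℕ i)) (sym (toℕ-fromℕ< _)) (Step-prevℕ (toℕ i))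

  CycAdj-next : ∀ i → CycAdj k i (next i)
  CycAdj-next i = inj₁ (Step-next i)

  Consec-functional : ∀ {i j j′} → Consec k i j → Consec k i j′ → j ≡ j′
  Consec-functional {j = j} {j′} ij ij′ = toℕ-injective (Step-functional (toℕ<n j) (toℕ<n j′) ij ij′)

  next-or-prev : ∀ {i j} → CycAdj k i j → j ≡ next i ⊎ j ≡ prev i
  next-or-prev {i} (inj₁ ij) = inj₁ (Consec-functional ij (Step-next i))
  next-or-prev {i} {j} (inj₂ ji) = inj₂ (toℕ-injective (Step-injective ji (Step-prev i)))

  next≢prev : ∀ i → next i ≢ prev i
  next≢prev i e = no-2-cycle (Step-next i) (subst (λ j → Step (toℕ j) (toℕ i)) (sym e) (Step-prev i))

  other-neighbour : ∀ {i j} → CycAdj k i j →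
                    Σ (Fin k) λ l → CycAdj k i l × l ≢ j × (∀ l′ → CycAdj k i l′ → l′ ≡ j ⊎ l′ ≡ l)
  other-neighbour {i} ij with next-or-prev ij
  ... | inj₁ refl = prev i , inj₂ (Step-prev i) , (λ e → next≢prev i (sym e)) , λ _ → next-or-prev
  ... | inj₂ refl = next i , CycAdj-next i , next≢prev i , λ _ → Sum.swap ∘ next-or-prev

  -- Without s the cycle is the path through the indices above s, the wrap-around edge from k - 1
  -- to 0, and the indices below s; the two intervals are walked along in ℕ.
  module _ (Q : Fin k → Set) (s : Fin k)
           (closed : ∀ i j → CycAdj k i j → i ≢ s → j ≢ s → Q i → Q j) where

    private
      Qℕ : ℕ → Set
      Qℕ x = (x<k : x < k) → Q (fromℕ< x<k)

      fromℕ<≢s : ∀ {x} (x<k : x < k) → x ≢ toℕ s → fromℕ< x<k ≢ s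
      fromℕ<≢s x<k x≢s e = x≢s (trans (sym (toℕ-fromℕ< x<k)) (cong toℕ e))

      Step-⇔ : ∀ {x y} → x < k → y < k → Step x y → x ≢ toℕ s → y ≢ toℕ s → Qℕ x ⇔ Qℕ y
      Step-⇔ x<k y<k xy x≢s y≢s =
        mk⇔ (λ q _ → closed _ _ adj i≢s j≢s (q x<k)) (λ q _ → closed _ _ (Sum.swap adj) j≢s i≢s (q y<k))
        where
        adj = inj₁ (subst₂ Step (sym (toℕ-fromℕ< x<k)) (sym (toℕ-fromℕ< y<k)) xy)
        i≢s = fromℕ<≢s x<k x≢s
        j≢s = fromℕ<≢s y<k y≢s

      below : ∀ x → x < toℕ s → Qℕ 0 ⇔ Qℕ x
      below x = interval-⇔ Qℕ 0 (toℕ s) link x z≤n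
        where
        link : ∀ y → 0 ≤ y → suc y < toℕ s → Qℕ y ⇔ Qℕ (suc y)
        link y _ y+1<s = Step-⇔ (<-trans y<s (toℕ<n s)) (<-trans y+1<s (toℕ<n s)) (inj₁ refl)
                                (λ e → <-irrefl e y<s) (λ e → <-irrefl e y+1<s)
          where y<s = <-trans (n<1+n y) y+1<s

      above : ∀ x → toℕ s < x → x < k → Qℕ (suc (toℕ s)) ⇔ Qℕ x
      above = interval-⇔ Qℕ (suc (toℕ s)) k link
        where
        link : ∀ y → toℕ s < y → suc y < k → Qℕ y ⇔ Qℕ (suc y)
        link y s<y y+1<k = Step-⇔ (<-trans (n<1+n y) y+1<k) y+1<k (inj₁ refl)
                                  (λ e → <-irrefl (sym e) s<y) (λ e → <-irrefl (sym e) (<-trans s<y (n<1+n y)))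

      across : ∀ x y → x < toℕ s → toℕ s < y → y < k → Qℕ x ⇔ Qℕ y
      across x y x<s s<y y<k =
        ⇔.trans (⇔.sym (below x x<s))
          (⇔.trans wrap (⇔.trans (⇔.sym (above (pred k) s<k-1 pred-k<k)) (above y s<y y<k)))
        where
        s<k-1 = <-≤-trans s<y (<⇒≤pred y<k)
        wrap : Qℕ 0 ⇔ Qℕ (pred k)
        wrap = ⇔.sym (Step-⇔ pred-k<k 0<k (inj₂ (suc-pred k , refl))
                             (λ e → <-irrefl (sym e) s<k-1) (λ e → <-irrefl e (≤-<-trans z≤n x<s)))

      Qℕ-connected : ∀ x y → x < k → y < k → x ≢ toℕ s → y ≢ toℕ s → Qℕ x → Qℕ y
      Qℕ-connected x y x<k y<k x≢s y≢s with <-cmp x (toℕ s) | <-cmp y (toℕ s)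
      ... | tri≈ _ x≡s _ | _              = ⊥-elim (x≢s x≡s)
      ... | _            | tri≈ _ y≡s _   = ⊥-elim (y≢s y≡s)
      ... | tri< x<s _ _ | tri< y<s _ _   = Equivalence.to (⇔.trans (⇔.sym (below x x<s)) (below y y<s))
      ... | tri< x<s _ _ | tri> _ _ s<y   = Equivalence.to (across x y x<s s<y y<k)
      ... | tri> _ _ s<x | tri< y<s _ _   = Equivalence.from (across y x y<s s<x x<k)
      ... | tri> _ _ s<x | tri> _ _ s<y   = Equivalence.to (⇔.trans (⇔.sym (above x s<x x<k)) (above y s<y y<k))

    cycle-connected : ∀ i j → i ≢ s → j ≢ s → Q i → Q j
    cycle-connected i j i≢s j≢s qi =
      subst Q (fromℕ<-toℕ j (toℕ<n j))
        (Qℕ-connected (toℕ i) (toℕ j) (toℕ<n i) (toℕ<n j) (i≢s ∘ toℕ-injective) (j≢s ∘ toℕ-injective)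
                      (λ i<k → subst Q (sym (fromℕ<-toℕ i i<k)) qi) (toℕ<n j))

module _ {m : ℕ} {G : Graph m} (K : Hole G) where

  private
    module C = Cycle (len K) (len≥4 K)

    to-cyc : ∀ {i j} → Adj G (vtx K i) (vtx K j) → CycAdj (len K) i j
    to-cyc = Equivalence.to (adj⇔ K _ _)

    from-cyc : ∀ {i j} → CycAdj (len K) i j → Adj G (vtx K i) (vtx K j)
    from-cyc = Equivalence.from (adj⇔ K _ _)

  record OtherNeighbour (x y : Fin m) : Set where
    field
      other   : Fin m
      other∈  : other ∈H K
      adj     : Adj G x other
      other≢  : other ≢ y
      only    : ∀ {w} → w ∈H K → Adj G x w → w ≡ y ⊎ w ≡ other

  neighbour : ∀ {x} → x ∈H K → Σ (Fin m) λ y → y ∈H K × Adj G x y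
  neighbour (i , refl) = vtx K (C.next i) , (C.next i , refl) , from-cyc (C.CycAdj-next i)

  other-neighbour : ∀ {x y} → x ∈H K → y ∈H K → Adj G x y → OtherNeighbour x y
  other-neighbour (i , refl) (j , refl) xy with C.other-neighbour (to-cyc xy)
  ... | l , il , l≢j , only = record
    { other  = vtx K l
    ; other∈ = l , refl
    ; adj    = from-cyc il
    ; other≢ = l≢j ∘ inj K
    ; only   = λ { (l′ , refl) a → Sum.map (cong (vtx K)) (cong (vtx K)) (only l′ (to-cyc a)) }
    }

  triangle-free : ∀ {x y z} → x ∈H K → y ∈H K → z ∈H K → Adj G x y → Adj G y z → Adj G x z → ⊥
  triangle-free (i , refl) (j , refl) (l , refl) xy yz xz =
    C.triangle-free i j l (to-cyc xy) (to-cyc yz) (to-cyc xz)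

  Adj? : ∀ {x y} → x ∈H K → y ∈H K → Dec (Adj G x y)
  Adj? (i , refl) (j , refl) = map′ from-cyc to-cyc (C.CycAdj? i j)

  connected-minus : (Q : Fin m → Set) {s : Fin m} → s ∈H K →
    (∀ {x y} → x ∈H K → y ∈H K → Adj G x y → x ≢ s → y ≢ s → Q x → Q y) →
    ∀ {x y} → x ∈H K → y ∈H K → x ≢ s → y ≢ s → Q x → Q y
  connected-minus Q (is , refl) closed (i , refl) (j , refl) x≢s y≢s =
    C.cycle-connected (Q ∘ vtx K) is
      (λ i j ij i≢s j≢s → closed (i , refl) (j , refl) (from-cyc ij) (i≢s ∘ inj K) (j≢s ∘ inj K))
      i j (x≢s ∘ cong (vtx K)) (y≢s ∘ cong (vtx K))

module TreeOrder {n : ℕ} (T : BurlingTree n) where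

  open BurlingTree T

  infix 4 _⊑_ _⊏_

  data _⊑_ (x : Fin n) : Fin n → Set where
    ⊑-refl  : x ⊑ x
    ⊑-child : ∀ {u y} → par y ≡ just u → x ⊑ u → x ⊑ y

  _⊏_ : Fin n → Fin n → Set
  x ⊏ y = x ⊑ y × x ≢ y

  private
    height : ∀ {v} → ReachRoot par root v → ℕ
    height here        = 0
    height (there _ p) = suc (height p)

    height-unique : ∀ {v} (p q : ReachRoot par root v) → height p ≡ height q
    height-unique here          here          = refl
    height-unique here          (there pv _)  with () ← trans (sym par-root) pv
    height-unique (there pv _)  here          with () ← trans (sym par-root) pv
    height-unique (there pv p)  (there pv′ q) with refl ← just-injective (trans (sym pv) pv′) =
      cong suc (height-unique p q)

  depth : Fin n → ℕ
  depth v = height (reach v)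

  depth-child : ∀ {u v} → par v ≡ just u → depth v ≡ suc (depth u)
  depth-child {u} {v} pv = height-unique (reach v) (there pv (reach u))

  ⊑-trans : ∀ {x y z} → x ⊑ y → y ⊑ z → x ⊑ z
  ⊑-trans x⊑y ⊑-refl         = x⊑y
  ⊑-trans x⊑y (⊑-child pz y⊑u) = ⊑-child pz (⊑-trans x⊑y y⊑u)

  ⊑-depth : ∀ {x y} → x ⊑ y → depth x ≤ depth y
  ⊑-depth ⊑-refl           = ≤-refl
  ⊑-depth (⊑-child py x⊑u) rewrite depth-child py = m≤n⇒m≤1+n (⊑-depth x⊑u)

  ⊑-child⇒⊏ : ∀ {x u y} → par y ≡ just u → x ⊑ u → x ⊏ y
  ⊑-child⇒⊏ py x⊑u = ⊑-child py x⊑u , λ { refl → <-irrefl (depth-child py) (s≤s (⊑-depth x⊑u)) }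

  ⊑-depth-≡ : ∀ {x y} → x ⊑ y → depth x ≡ depth y → x ≡ y
  ⊑-depth-≡ ⊑-refl           _ = refl
  ⊑-depth-≡ (⊑-child py x⊑u) e = ⊥-elim (<-irrefl e (subst (_ <_) (sym (depth-child py)) (s≤s (⊑-depth x⊑u))))

  ⊑-antisym : ∀ {x y} → x ⊑ y → y ⊑ x → x ≡ y
  ⊑-antisym x⊑y y⊑x = ⊑-depth-≡ x⊑y (≤-antisym (⊑-depth x⊑y) (⊑-depth y⊑x))

  ⊏-depth : ∀ {x y} → x ⊏ y → depth x < depth y
  ⊏-depth (x⊑y , x≢y) with m≤n⇒m<n∨m≡n (⊑-depth x⊑y)
  ... | inj₁ lt = lt
  ... | inj₂ eq = ⊥-elim (x≢y (⊑-depth-≡ x⊑y eq))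

  ⊏-asym : ∀ {x y} → x ⊏ y → ¬ y ⊏ x
  ⊏-asym x⊏y y⊏x = <-asym (⊏-depth x⊏y) (⊏-depth y⊏x)

  ⊏-⊑-trans : ∀ {x y z} → x ⊏ y → y ⊑ z → x ⊏ z
  ⊏-⊑-trans (x⊑y , x≢y) y⊑z = ⊑-trans x⊑y y⊑z , λ { refl → x≢y (⊑-antisym x⊑y y⊑z) }

  ⊏-parent : ∀ {x y u} → x ⊏ y → par y ≡ just u → x ⊑ u
  ⊏-parent (⊑-refl , x≢x)        _  = ⊥-elim (x≢x refl)
  ⊏-parent (⊑-child py′ x⊑u , _) py with refl ← just-injective (trans (sym py′) py) = x⊑u

  ⊑-linear : ∀ {x y z} → x ⊑ z → y ⊑ z → x ⊑ y ⊎ y ⊑ x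
  ⊑-linear ⊑-refl             y⊑z              = inj₂ y⊑z
  ⊑-linear (⊑-child pz x⊑u)   ⊑-refl           = inj₁ (⊑-child pz x⊑u)
  ⊑-linear (⊑-child pz x⊑u)   (⊑-child pz′ y⊑u′) with refl ← just-injective (trans (sym pz) pz′) =
    ⊑-linear x⊑u y⊑u′

  chain-⊑ : ∀ {h vs x} → Chain par (h ∷ vs) → x ∈ (h ∷ vs) → h ⊑ x
  chain-⊑ _            (here refl)   = ⊑-refl
  chain-⊑ [ _ ]        (there ())
  chain-⊑ (step pw ch) (there x∈)    = ⊑-trans (⊑-child pw ⊑-refl) (chain-⊑ ch x∈)

  chain-linear : ∀ {h vs x y} → Chain par (h ∷ vs) → x ∈ (h ∷ vs) → y ∈ (h ∷ vs) → x ⊑ y ⊎ y ⊑ x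
  chain-linear ch          (here refl) y∈          = inj₁ (chain-⊑ ch y∈)
  chain-linear ch          (there x∈)  (here refl) = inj₂ (chain-⊑ ch (there x∈))
  chain-linear [ _ ]       (there ())  (there _)
  chain-linear (step _ ch) (there x∈)  (there y∈)  = chain-linear ch x∈ y∈

  chain-convex : ∀ {h vs b z} → Chain par (h ∷ vs) → b ∈ (h ∷ vs) → h ⊑ z → z ⊑ b → z ∈ (h ∷ vs)
  chain-convex _ (here refl) h⊑z z⊑h = here (sym (⊑-antisym h⊑z z⊑h))
  chain-convex [ _ ] (there ()) _ _
  chain-convex {z = z} (step {w = w} pw ch) (there b∈) h⊑z z⊑b with z ≟ᶠ w
  ... | yes refl = there (here refl)
  ... | no z≢w with ⊑-linear (chain-⊑ ch b∈) z⊑b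
  ...   | inj₁ w⊑z = there (chain-convex ch b∈ w⊑z z⊑b)
  ...   | inj₂ z⊑w = here (⊑-antisym (⊏-parent (z⊑w , z≢w) pw) h⊑z)

  record ArcBranch (a : Fin n) : Set where
    field
      parent   : Fin n
      parent-a : par a ≡ just parent
      a≢last   : ℓ parent ≢ a
      rest     : List (Fin n)
      branch   : Chain par (ℓ parent ∷ rest)
      targets  : ∀ x → c a x ⇔ x ∈ (ℓ parent ∷ rest)

  arc-branch : ∀ {a b} → c a b → ArcBranch a
  arc-branch {a} {b} ab with par a in pa
  ... | nothing = ⊥-elim (c-root b (subst (λ w → c w b) (par-other a pa) ab))
  ... | just u with ℓ u ≟ᶠ a
  ...   | yes ℓu≡a = ⊥-elim (c-last a u pa ℓu≡a b ab)
  ...   | no ℓu≢a with c-branch a u pa ℓu≢a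
  ...     | inj₁ no-arcs          = ⊥-elim (no-arcs b ab)
  ...     | inj₂ (vs , ch , c⇔∈) = record
    { parent = u ; parent-a = pa ; a≢last = ℓu≢a ; rest = vs ; branch = ch ; targets = c⇔∈ }

  arc-targets-linear : ∀ {a b b′} → c a b → c a b′ → b ⊑ b′ ⊎ b′ ⊑ b
  arc-targets-linear {a} {b} {b′} ab ab′ = chain-linear branch (to (targets b) ab) (to (targets b′) ab′)
    where
    open ArcBranch (arc-branch ab)
    open Equivalence

  module _ {a b} (ab : c a b) where
    open ArcBranch (arc-branch ab)

    private
      last-child : par (ℓ parent) ≡ just parent
      last-child = ℓ-child parent a parent-a

      last⊑b : ℓ parent ⊑ b
      last⊑b = chain-⊑ branch (Equivalence.to (targets b) ab)

      between : ∀ {z} → ℓ parent ⊑ z → z ⊑ b → c a z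
      between {z} l⊑z z⊑b = Equivalence.from (targets z) (chain-convex branch (Equivalence.to (targets b) ab) l⊑z z⊑b)

      depth-a : depth a ≡ depth (ℓ parent)
      depth-a = trans (depth-child parent-a) (sym (depth-child last-child))

    arc-depth-≤ : depth a ≤ depth b
    arc-depth-≤ = subst (_≤ depth b) (sym depth-a) (⊑-depth last⊑b)

    -- an arc to a vertex of the same depth ends at the last-born ℓ parent
    arc-level-sink : depth a ≡ depth b → ∀ x → ¬ c b x
    arc-level-sink e x bx = c-last b parent (subst (λ w → par w ≡ just parent) l≡b last-child) l≡b x bx
      where l≡b = ⊑-depth-≡ last⊑b (trans (sym depth-a) e)

    arc-¬⊑ : ¬ a ⊑ b
    arc-¬⊑ a⊑b with ⊑-linear a⊑b last⊑b
    ... | inj₁ a⊑l = a≢last (sym (⊑-depth-≡ a⊑l depth-a))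
    ... | inj₂ l⊑a = a≢last (⊑-depth-≡ l⊑a (sym depth-a))

    arc-¬⊒ : ¬ b ⊑ a
    arc-¬⊒ b⊑a = a≢last (⊑-depth-≡ (⊑-trans last⊑b b⊑a) (sym depth-a))

    ⊏-arc : ∀ {x} → x ⊏ a → x ⊏ b
    ⊏-arc x⊏a = ⊏-⊑-trans (⊑-child⇒⊏ last-child (⊏-parent x⊏a parent-a)) last⊑b

    ⊏-arc⁻¹ : ∀ {x} → x ⊏ b → x ⊏ a ⊎ c a x
    ⊏-arc⁻¹ {x} (x⊑b , _) with ⊑-linear last⊑b x⊑b
    ... | inj₁ l⊑x = inj₂ (between l⊑x x⊑b)
    ... | inj₂ x⊑l with x ≟ᶠ ℓ parent
    ...   | yes refl = inj₂ (between ⊑-refl x⊑b)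
    ...   | no x≢l   = inj₁ (⊑-child⇒⊏ parent-a (⊏-parent (x⊑l , x≢l) last-child))

  arc-antisym : ∀ {a b} → c a b → ¬ c b a
  arc-antisym {a} ab ba = arc-level-sink ab (≤-antisym (arc-depth-≤ ab) (arc-depth-≤ ba)) a ba

module FlowerStructure {m : ℕ} {G : Graph m} (F : IsFlower G) where

  open IsFlower F

  private
    InEdge⇒∈H : ∀ {e z} → InEdge H e z → z ∈H H
    InEdge⇒∈H {e} (inj₁ eq)           = e , eq
    InEdge⇒∈H     (inj₂ (j , _ , eq)) = j , eq

  record PetalAt (a b : Fin m) : Set where
    field
      index : Fin (len H)
      a∈    : a ∈H petal index
      b∈    : b ∈H petal index
      ends  : ∀ {z} → z ∈H petal index → z ∈H H → z ≡ a ⊎ z ≡ b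

    hole : Hole G
    hole = petal index

  PetalAt-swap : ∀ {a b} → PetalAt a b → PetalAt b a
  PetalAt-swap P = record { index = index ; a∈ = b∈ ; b∈ = a∈ ; ends = λ z∈P z∈H → Sum.swap (ends z∈P z∈H) }
    where
    open PetalAt P

  private
    petal-at-edge : ∀ i j → Consec (len H) i j → PetalAt (vtx H i) (vtx H j)
    petal-at-edge i j ij = record
      { index = i ; a∈ = InEdge⇒∈petal (inj₁ refl) ; b∈ = InEdge⇒∈petal (inj₂ (j , ij , refl)) ; ends = ends }
      where
      InEdge⇒∈petal : ∀ {z} → InEdge H i z → z ∈H petal i
      InEdge⇒∈petal ie = proj₂ (Equivalence.from (meetH i _) ie)

      ends : ∀ {z} → z ∈H petal i → z ∈H H → z ≡ vtx H i ⊎ z ≡ vtx H j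
      ends z∈P z∈H with Equivalence.to (meetH i _) (z∈H , z∈P)
      ... | inj₁ refl             = inj₁ refl
      ... | inj₂ (j′ , ij′ , refl) = inj₂ (cong (vtx H) (Cycle.Consec-functional (len H) (len≥4 H) ij′ ij))

  petal-at : ∀ {a b} → a ∈H H → b ∈H H → Adj G a b → PetalAt a b
  petal-at (i , refl) (j , refl) ab with Equivalence.to (adj⇔ H i j) ab
  ... | inj₁ ij = petal-at-edge i j ij
  ... | inj₂ ji = PetalAt-swap (petal-at-edge j i ji)

  petal-closed : ∀ e {z y} → z ∈H petal e → Adj G z y → y ∈H petal e ⊎ z ∈H H
  petal-closed e {z} {y} z∈e zy with coverE z y zy
  ... | j , z∈j , y∈j with j ≟ᶠ e
  ...   | yes refl = inj₁ y∈j
  ...   | no j≢e   = inj₂ (InEdge⇒∈H (proj₁ (Equivalence.to (meetP e j (j≢e ∘ sym) z) (z∈e , z∈j))))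

  module _ {a b c} (P : PetalAt a b) (Q : PetalAt a c) where
    private
      module P = PetalAt P
      module Q = PetalAt Q

    petals-meet : c ∈H H → c ≢ a → c ≢ b → ∀ {z} → z ∈H P.hole → z ∈H Q.hole → z ≡ a
    petals-meet c∈H c≢a c≢b {z} z∈P z∈Q with P.index ≟ᶠ Q.index
    ... | yes same = ⊥-elim (Sum.[ c≢a , c≢b ] (P.ends (subst (λ e → c ∈H petal e) (sym same) Q.b∈) c∈H))
    ... | no differ with InEdge⇒∈H (proj₁ (Equivalence.to (meetP P.index Q.index differ z) (z∈P , z∈Q)))
    ...   | z∈H with P.ends z∈P z∈H | Q.ends z∈Q z∈H
    ...     | inj₁ z≡a  | _         = z≡a
    ...     | inj₂ _    | inj₁ z≡a  = z≡a
    ...     | inj₂ refl | inj₂ refl = ⊥-elim (c≢b refl)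

argmin-Fin : ∀ {k} → Fin k → (g : Fin k → ℕ) → Σ (Fin k) λ i → ∀ j → g i ≤ g j
argmin-Fin i₀ g = argmin g i₀ (allFin _) , λ j → All.lookup (f[argmin]≤f[xs] i₀ (allFin _)) (∈-allFin j)

module BurlingRepresentation {m : ℕ} (G : Graph m) {n : ℕ} (T : BurlingTree n) (f : Fin m → Fin n)
         (f-injective : Injective _≡_ _≡_ f)
         (adj⇔arc : ∀ x y → Adj G x y ⇔ (BurlingTree.c T (f x) (f y) ⊎ BurlingTree.c T (f y) (f x))) where

  open TreeOrder T

  infix 4 _⟶_ _above_

  _⟶_ : Fin m → Fin m → Set
  x ⟶ y = BurlingTree.c T (f x) (f y)

  _above_ : Fin m → Fin m → Set
  x above y = f x ⊏ f y

  private
    adj-sym : ∀ {x y} → Adj G x y → Adj G y x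
    adj-sym = Graph.sym G

    adj⇒≢ : ∀ {x y} → Adj G x y → x ≢ y
    adj⇒≢ xy refl = Graph.irrefl G xy

  adj⇒arc : ∀ {x y} → Adj G x y → x ⟶ y ⊎ y ⟶ x
  adj⇒arc = Equivalence.to (adj⇔arc _ _)

  above⇒≢ : ∀ {x y} → x above y → x ≢ y
  above⇒≢ (_ , fx≢fy) refl = fx≢fy refl

  adj⇒¬above : ∀ {x y} → Adj G x y → ¬ x above y
  adj⇒¬above xy (fx⊑fy , _) with adj⇒arc xy
  ... | inj₁ x⟶y = arc-¬⊑ x⟶y fx⊑fy
  ... | inj₂ y⟶x = arc-¬⊒ y⟶x fx⊑fy

  adj⇒¬below : ∀ {x y} → Adj G x y → ¬ y above x
  adj⇒¬below = adj⇒¬above ∘ adj-sym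

  out-neighbours-linear : ∀ {x y z} → x ⟶ y → x ⟶ z → y ≢ z → y above z ⊎ z above y
  out-neighbours-linear x⟶y x⟶z y≢z with arc-targets-linear x⟶y x⟶z
  ... | inj₁ fy⊑fz = inj₁ (fy⊑fz , y≢z ∘ f-injective)
  ... | inj₂ fz⊑fy = inj₂ (fz⊑fy , y≢z ∘ sym ∘ f-injective)

  above-⟶ : ∀ {x y z} → x above y → y ⟶ z → x above z
  above-⟶ x>y y⟶z = ⊏-arc y⟶z x>y

  above-⟵ : ∀ {x y z} → x above y → z ⟶ y → x above z ⊎ z ⟶ x
  above-⟵ x>y z⟶y = ⊏-arc⁻¹ z⟶y x>y

  above-adj : ∀ {x y z} → x above y → Adj G y z → x above z ⊎ Adj G z x
  above-adj x>y yz with adj⇒arc yz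
  ... | inj₁ y⟶z = inj₁ (above-⟶ x>y y⟶z)
  ... | inj₂ z⟶y = Sum.map₂ (Equivalence.from (adj⇔arc _ _) ∘ inj₁) (above-⟵ x>y z⟶y)

  ⟶-lower-neighbour : ∀ {x y z} → x above y → Adj G z x → Adj G z y → z ⟶ y
  ⟶-lower-neighbour x>y zx zy with adj⇒arc zy
  ... | inj₁ z⟶y = z⟶y
  ... | inj₂ y⟶z = ⊥-elim (adj⇒¬below zx (above-⟶ x>y y⟶z))

  IsSource : Hole G → Fin m → Set
  IsSource K s = s ∈H K × (∀ {y} → y ∈H K → Adj G s y → s ⟶ y)

  IsPeak : Hole G → Fin m → Set
  IsPeak K π = π ∈H K × (∀ {z} → z ∈H K → z ≢ π → ¬ Adj G z π → π above z)

  module _ (K : Hole G) where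

    private
      IsLowest : Fin m → Set
      IsLowest x = x ∈H K × (∀ {z} → z ∈H K → depth (f x) ≤ depth (f z))

      lowest : Σ (Fin m) IsLowest
      lowest with argmin-Fin (fromℕ< (<-≤-trans z<s (len≥4 K))) (depth ∘ f ∘ vtx K)
      ... | i , min = vtx K i , (i , refl) , λ { (j , refl) → min j }

      -- y ⟶ x with x lowest puts y on the level of x, so an arc w ⟶ y would make y a last-born
      in-arc-source : ∀ {x y} → IsLowest x → y ∈H K → y ⟶ x → IsSource K y
      in-arc-source {x} {y} (_ , lowest-x) y∈ y⟶x = y∈ , λ {w} w∈ yw → out (adj⇒arc yw) w∈
        where
        out : ∀ {w} → y ⟶ w ⊎ w ⟶ y → w ∈H K → y ⟶ w
        out (inj₁ y⟶w) _  = y⟶w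
        out (inj₂ w⟶y) w∈ = ⊥-elim (arc-level-sink w⟶y level (f x) y⟶x)
          where level = ≤-antisym (arc-depth-≤ w⟶y) (≤-trans (arc-depth-≤ y⟶x) (lowest-x w∈))

    source-exists : Σ (Fin m) (IsSource K)
    source-exists with lowest
    ... | x , low@(x∈ , _) with neighbour K x∈
    ...   | y , y∈ , xy with adj⇒arc xy | other-neighbour K x∈ y∈ xy
    ...     | inj₂ y⟶x | _ = y , in-arc-source low y∈ y⟶x
    ...     | inj₁ x⟶y | o with adj⇒arc (OtherNeighbour.adj o)
    ...       | inj₂ z⟶x = _ , in-arc-source low (OtherNeighbour.other∈ o) z⟶x
    ...       | inj₁ x⟶z =
      x , x∈ , λ w∈ xw → Sum.[ (λ { refl → x⟶y }) , (λ { refl → x⟶z }) ] (OtherNeighbour.only o w∈ xw)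

    peak-beside-source : ∀ {s a b} → s ∈H K → a ∈H K → Adj G s a →
      (∀ {w} → w ∈H K → Adj G s w → w ≡ a ⊎ w ≡ b) → a above b → IsPeak K a
    peak-beside-source {s} {a} {b} s∈ a∈ sa s-nbrs a>b =
      a∈ , λ z∈ z≢a ¬za → above-of (from-a z∈ λ { refl → ¬za (adj-sym aa′) }) z≢a ¬za
      where
      open OtherNeighbour (other-neighbour K a∈ s∈ (adj-sym sa))
        using () renaming (other to a′; other∈ to a′∈; adj to aa′; only to a-nbrs)

      Q : Fin m → Set
      Q z = a above z ⊎ z ≡ a ⊎ z ≡ s

      above-of : ∀ {z} → Q z → z ≢ a → ¬ Adj G z a → a above z
      above-of (inj₁ a>z)         _   _   = a>z
      above-of (inj₂ (inj₁ z≡a))  z≢a _   = ⊥-elim (z≢a z≡a)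
      above-of (inj₂ (inj₂ refl)) _   ¬sa = ⊥-elim (¬sa sa)

      next-to-a : ∀ {y} → y ∈H K → Adj G y a → y ≢ a′ → Q y
      next-to-a y∈ ya y≢a′ with a-nbrs y∈ (adj-sym ya)
      ... | inj₁ y≡s  = inj₂ (inj₂ y≡s)
      ... | inj₂ y≡a′ = ⊥-elim (y≢a′ y≡a′)

      closed : ∀ {x y} → x ∈H K → y ∈H K → Adj G x y → x ≢ a′ → y ≢ a′ → Q x → Q y
      closed _ y∈ xy _ y≢a′ (inj₁ a>x) with above-adj a>x xy
      ... | inj₁ a>y = inj₁ a>y
      ... | inj₂ ya  = next-to-a y∈ ya y≢a′
      closed _ y∈ ay _ y≢a′ (inj₂ (inj₁ refl)) = next-to-a y∈ (adj-sym ay) y≢a′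
      closed _ y∈ sy _ _    (inj₂ (inj₂ refl)) with s-nbrs y∈ sy
      ... | inj₁ refl = inj₂ (inj₁ refl)
      ... | inj₂ refl = inj₁ a>b

      from-a : ∀ {z} → z ∈H K → z ≢ a′ → Q z
      from-a z∈ z≢a′ = connected-minus K Q a′∈ closed a∈ z∈ (adj⇒≢ aa′) z≢a′ (inj₂ (inj₁ refl))

    peak-exists : Σ (Fin m) (IsPeak K)
    peak-exists with source-exists
    ... | s , s∈ , s⟶ with neighbour K s∈
    ...   | a , a∈ , sa with other-neighbour K s∈ a∈ sa
    ...     | record { other = b ; other∈ = b∈ ; adj = sb ; other≢ = b≢a ; only = s-nbrs }
              with out-neighbours-linear (s⟶ a∈ sa) (s⟶ b∈ sb) (b≢a ∘ sym)
    ...       | inj₁ a>b = a , peak-beside-source s∈ a∈ sa s-nbrs a>b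
    ...       | inj₂ b>a = b , peak-beside-source s∈ b∈ sb (λ w∈ sw → Sum.swap (s-nbrs w∈ sw)) b>a

    above-spreads : ∀ {x s z₀} → s ∈H K → z₀ ∈H K → z₀ ≢ s → x above z₀ →
      (∀ {z} → z ∈H K → z ≢ s → ¬ Adj G z x) → ∀ {z} → z ∈H K → z ≢ s → x above z
    above-spreads {x} {s} s∈ z₀∈ z₀≢s x>z₀ no-nbr z∈ z≢s =
      connected-minus K (x above_) s∈ closed z₀∈ z∈ z₀≢s z≢s x>z₀
      where
      closed : ∀ {y y′} → y ∈H K → y′ ∈H K → Adj G y y′ → y ≢ s → y′ ≢ s → x above y → x above y′
      closed _ y′∈ yy′ _ y′≢s x>y = Sum.[ id , (λ y′x → ⊥-elim (no-nbr y′∈ y′≢s y′x)) ] (above-adj x>y yy′)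

    ⟶-peak : ∀ {π y} → IsPeak K π → y ∈H K → Adj G y π → y ⟶ π
    ⟶-peak (π∈ , π-peak) y∈ yπ with other-neighbour K y∈ π∈ yπ
    ... | record { other∈ = w∈ ; adj = yw ; other≢ = w≢π } =
      Sum.[ (λ π>y → ⊥-elim (adj⇒¬below yπ π>y)) , id ] (above-⟵ π>w (⟶-lower-neighbour π>w yπ yw))
      where π>w = π-peak w∈ w≢π (λ wπ → triangle-free K y∈ w∈ π∈ yw wπ yπ)

  module _ (F : IsFlower G) where

    open IsFlower F using (H; petal)
    open FlowerStructure F

    -- a petal vertex off H has all its neighbours in its petal
    petal-vertex-spreads : ∀ {e w s z₀} (K : Hole G) → w ∈H petal e → ¬ w ∈H H →
      s ∈H K → z₀ ∈H K → z₀ ≢ s → w above z₀ →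
      (∀ {z} → z ∈H K → z ∈H petal e → z ≡ s ⊎ ¬ Adj G z w) →
      ∀ {z} → z ∈H K → z ≢ s → w above z
    petal-vertex-spreads {e} K w∈P w∉H s∈ z₀∈ z₀≢s w>z₀ K∩P =
      above-spreads K s∈ z₀∈ z₀≢s w>z₀ λ z∈ z≢s zw →
        Sum.[ (λ z∈P → Sum.[ z≢s , (λ ¬zw → ¬zw zw) ] (K∩P z∈ z∈P)) , w∉H ] (petal-closed e w∈P (adj-sym zw))

    module AtPeak {u : Fin m} (u-peak : IsPeak H u) where

      private
        u∈H : u ∈H H
        u∈H = proj₁ u-peak

      module Edge {t : Fin m} (t∈H : t ∈H H) (tu : Adj G t u) where

        P : PetalAt t u
        P = petal-at t∈H u∈H tu

        module P = PetalAt P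

        -- v is the other neighbour of t on H, and q, r are the other neighbours of t on the petals P, P′
        -- at the edges tu and tv.
        private
          open OtherNeighbour (other-neighbour H t∈H u∈H tu)
            using () renaming (other to v; other∈ to v∈H; adj to tv; other≢ to v≢u)

          P′ : PetalAt t v
          P′ = petal-at t∈H v∈H tv

          module P′ = PetalAt P′
          module q = OtherNeighbour (other-neighbour P.hole P.a∈ P.b∈ tu)
          module r = OtherNeighbour (other-neighbour P′.hole P′.a∈ P′.b∈ tv)

          u≢t : u ≢ t
          u≢t = adj⇒≢ tu ∘ sym

          v≢t : v ≢ t
          v≢t = adj⇒≢ tv ∘ sym

          q≢t : q.other ≢ t
          q≢t = adj⇒≢ q.adj ∘ sym

          r≢t : r.other ≢ t
          r≢t = adj⇒≢ r.adj ∘ sym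

          P∩P′ : ∀ {z} → z ∈H P.hole → z ∈H P′.hole → z ≡ t
          P∩P′ = petals-meet P P′ v∈H v≢t v≢u

          q∉H : ¬ q.other ∈H H
          q∉H q∈H = Sum.[ q≢t , q.other≢ ] (P.ends q.other∈ q∈H)

          r∉H : ¬ r.other ∈H H
          r∉H r∈H = Sum.[ r≢t , r.other≢ ] (P′.ends r.other∈ r∈H)

          u>v : u above v
          u>v = proj₂ u-peak v∈H v≢u (λ vu → triangle-free H t∈H v∈H u∈H tv vu tu)

          u>r : u above r.other
          u>r = above-spreads P′.hole P′.a∈ P′.b∈ v≢t u>v u-alone r.other∈ r≢t
            where
            u-alone : ∀ {z} → z ∈H P′.hole → z ≢ t → ¬ Adj G z u
            u-alone z∈P′ z≢t zu with petal-closed P′.index z∈P′ zu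
            ... | inj₁ u∈P′ = Sum.[ u≢t , above⇒≢ u>v ] (P′.ends u∈P′ u∈H)
            ... | inj₂ z∈H  =
              Sum.[ z≢t , (λ z≡v → adj⇒¬below (subst (λ w → Adj G w u) z≡v zu) u>v) ] (P′.ends z∈P′ z∈H)

          t⟶v : t ⟶ v
          t⟶v = ⟶-lower-neighbour u>v tu tv

          t⟶r : t ⟶ r.other
          t⟶r = ⟶-lower-neighbour u>r tu r.adj

          v>r : v above r.other
          v>r with out-neighbours-linear t⟶v t⟶r (r.other≢ ∘ sym)
          ... | inj₁ v>r = v>r
          ... | inj₂ r>v =
            ⊥-elim (⊏-asym u>r (petal-vertex-spreads H r.other∈ r∉H t∈H v∈H v≢t r>v H∩P′ u∈H u≢t))
            where
            H∩P′ : ∀ {z} → z ∈H H → z ∈H P′.hole → z ≡ t ⊎ ¬ Adj G z r.other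
            H∩P′ z∈H z∈P′ =
              Sum.map₂ (λ z≡v zr → adj⇒¬below (subst (λ w → Adj G w r.other) z≡v zr) r>v) (P′.ends z∈P′ z∈H)

          q≢v : q.other ≢ v
          q≢v q≡v = q∉H (subst (_∈H H) (sym q≡v) v∈H)

          q≢r : q.other ≢ r.other
          q≢r q≡r = q≢t (P∩P′ q.other∈ (subst (_∈H P′.hole) (sym q≡r) r.other∈))

          ¬u>q : ¬ u above q.other
          ¬u>q u>q = refute (out-neighbours-linear t⟶q t⟶v q≢v) (out-neighbours-linear t⟶q t⟶r q≢r)
            where
            t⟶q : t ⟶ q.other
            t⟶q = ⟶-lower-neighbour u>q tu q.adj

            H∩P : ∀ {z} → z ∈H H → z ∈H P.hole → z ≡ t ⊎ ¬ Adj G z q.other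
            H∩P z∈H z∈P =
              Sum.map₂ (λ z≡u zq → adj⇒¬above (subst (λ w → Adj G w q.other) z≡u zq) u>q) (P.ends z∈P z∈H)

            refute : q.other above v ⊎ v above q.other → q.other above r.other ⊎ r.other above q.other → ⊥
            refute (inj₁ q>v) _ =
              ⊏-asym u>q (petal-vertex-spreads H q.other∈ q∉H t∈H v∈H v≢t q>v H∩P u∈H u≢t)
            refute (inj₂ v>q) (inj₁ q>r) =
              ⊏-asym v>q (petal-vertex-spreads P′.hole q.other∈ q∉H P′.a∈ r.other∈ r≢t q>r
                                               (λ z∈P′ z∈P → inj₁ (P∩P′ z∈P z∈P′)) P′.b∈ v≢t)
            refute (inj₂ v>q) (inj₂ r>q) =
              ⊏-asym u>r (petal-vertex-spreads P.hole r.other∈ r∉H P.a∈ q.other∈ q≢t r>q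
                                               (λ z∈P z∈P′ → inj₁ (P∩P′ z∈P z∈P′)) P.b∈ u≢t)

          u-not-peak : ¬ IsPeak P.hole u
          u-not-peak (_ , u-peak-P) =
            ¬u>q (u-peak-P q.other∈ q.other≢ (λ qu → triangle-free P.hole P.a∈ q.other∈ P.b∈ q.adj qu tu))

          t-not-peak : ¬ IsPeak P.hole t
          t-not-peak t-peak = arc-antisym (⟶-peak H u-peak t∈H tu) (⟶-peak P.hole t-peak P.b∈ (adj-sym tu))

        petal-peak-∉H : ∀ {π} → IsPeak P.hole π → ¬ π ∈H H
        petal-peak-∉H π-peak π∈H with P.ends (proj₁ π-peak) π∈H
        ... | inj₁ refl = t-not-peak π-peak
        ... | inj₂ refl = u-not-peak π-peak

      module _ {t₁ t₂} (t₁∈H : t₁ ∈H H) (t₂∈H : t₂ ∈H H) (t₁u : Adj G t₁ u) (t₂u : Adj G t₂ u)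
               (t₁≢t₂ : t₁ ≢ t₂) where

        private
          module P₁ = PetalAt (Edge.P t₁∈H t₁u)
          module P₂ = PetalAt (Edge.P t₂∈H t₂u)

          P₁∩P₂ : ∀ {z} → z ∈H P₁.hole → z ∈H P₂.hole → z ≡ u
          P₁∩P₂ = petals-meet (PetalAt-swap (Edge.P t₁∈H t₁u)) (PetalAt-swap (Edge.P t₂∈H t₂u))
                              t₂∈H (adj⇒≢ t₂u) (t₁≢t₂ ∘ sym)

          ∉H⇒≢ : ∀ {x y} → ¬ x ∈H H → y ∈H H → x ≢ y
          ∉H⇒≢ x∉H y∈H x≡y = x∉H (subst (_∈H H) (sym x≡y) y∈H)

        petal-peaks-ordered : ∀ {π₁ π₂} → IsPeak P₁.hole π₁ → ¬ π₁ ∈H H → π₂ ∈H P₂.hole → ¬ π₂ ∈H H →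
                              π₁ above π₂
        petal-peaks-ordered {π₁} (π₁∈ , π₁-peak) π₁∉H π₂∈ π₂∉H with Adj? P₁.hole P₁.b∈ π₁∈
        ... | no ¬uπ₁ =
          petal-vertex-spreads P₂.hole π₁∈ π₁∉H P₂.a∈ P₂.b∈ (adj⇒≢ t₂u ∘ sym) π₁>u
            (λ z∈P₂ z∈P₁ → inj₂ λ zπ₁ → ¬uπ₁ (subst (λ w → Adj G w π₁) (P₁∩P₂ z∈P₁ z∈P₂) zπ₁))
            π₂∈ (∉H⇒≢ π₂∉H t₂∈H)
          where
          π₁>u : π₁ above u
          π₁>u = π₁-peak P₁.b∈ (∉H⇒≢ π₁∉H u∈H ∘ sym) ¬uπ₁
        ... | yes uπ₁ =
          petal-vertex-spreads P₂.hole π₁∈ π₁∉H P₂.b∈ P₂.a∈ (adj⇒≢ t₂u) π₁>t₂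
            (λ z∈P₂ z∈P₁ → inj₁ (P₁∩P₂ z∈P₁ z∈P₂)) π₂∈ (∉H⇒≢ π₂∉H u∈H)
          where
          ¬t₁π₁ : ¬ Adj G t₁ π₁
          ¬t₁π₁ t₁π₁ = triangle-free P₁.hole P₁.a∈ P₁.b∈ π₁∈ t₁u uπ₁ t₁π₁

          π₁>t₁ : π₁ above t₁
          π₁>t₁ = π₁-peak P₁.a∈ (∉H⇒≢ π₁∉H t₁∈H ∘ sym) ¬t₁π₁

          H∩P₁ : ∀ {z} → z ∈H H → z ∈H P₁.hole → z ≡ u ⊎ ¬ Adj G z π₁
          H∩P₁ z∈H z∈P₁ =
            Sum.swap (Sum.map₁ (λ z≡t₁ → ¬t₁π₁ ∘ subst (λ w → Adj G w π₁) z≡t₁) (P₁.ends z∈P₁ z∈H))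

          π₁>t₂ : π₁ above t₂
          π₁>t₂ = petal-vertex-spreads H π₁∈ π₁∉H u∈H t₁∈H (adj⇒≢ t₁u) π₁>t₁ H∩P₁ t₂∈H (adj⇒≢ t₂u)

    no-peak : ∀ {u} → ¬ IsPeak H u
    no-peak {u} u-peak@(u∈H , _) with neighbour H u∈H
    ... | t₁ , t₁∈H , ut₁ with other-neighbour H u∈H t₁∈H ut₁
    ...   | record { other = t₂ ; other∈ = t₂∈H ; adj = ut₂ ; other≢ = t₂≢t₁ } =
      peaks-ordered (peak-exists (Edge.P.hole t₁∈H t₁u)) (peak-exists (Edge.P.hole t₂∈H t₂u))
      where
      open AtPeak u-peak

      t₁u : Adj G t₁ u
      t₁u = adj-sym ut₁

      t₂u : Adj G t₂ u
      t₂u = adj-sym ut₂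

      peaks-ordered : Σ (Fin m) (IsPeak (Edge.P.hole t₁∈H t₁u)) →
                      Σ (Fin m) (IsPeak (Edge.P.hole t₂∈H t₂u)) → ⊥
      peaks-ordered (π₁ , π₁-peak) (π₂ , π₂-peak) =
        ⊏-asym (petal-peaks-ordered t₁∈H t₂∈H t₁u t₂u (t₂≢t₁ ∘ sym) π₁-peak π₁∉H (proj₁ π₂-peak) π₂∉H)
               (petal-peaks-ordered t₂∈H t₁∈H t₂u t₁u t₂≢t₁ π₂-peak π₂∉H (proj₁ π₁-peak) π₁∉H)
        where
        π₁∉H : ¬ π₁ ∈H H
        π₁∉H = Edge.petal-peak-∉H t₁∈H t₁u π₁-peak

        π₂∉H : ¬ π₂ ∈H H
        π₂∉H = Edge.petal-peak-∉H t₂∈H t₂u π₂-peak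

lemma7p1 : ∀ {m : ℕ} (G : Graph m) → IsFlower G → ¬ IsBurling G
lemma7p1 G F (_ , T , f , f-injective , adj⇔arc) = no-peak F (proj₂ (peak-exists (IsFlower.H F)))
  where
  open BurlingRepresentation G T f f-injective adj⇔arc
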